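{- Every path is outerplanar unavoidable. In particular, for every positive integer $n$, every coloring of the edges of ${\rm UOP}(n^2)$ with two colors red and blue contains a monochromatic copy of $P_n$.
   Context: $P_n$ denotes the path on $n$ vertices. A graph $H$ is outerplanar unavoidable if there exists an outerplanar graph $G$ such that every red/blue coloring of the edges of $G$ contains a monochromatic copy of $H$. The universal outerplanar graph ${\rm UOP}(k)$ is defined recursively: ${\rm UOP}(1)$ is a triangle, and all three of its edges are called outer edges. For $k>1$, ${\rm UOP}(k)$ is obtained from ${\rm UOP}(k-1)$ by adding, for each outer edge $e=xy$ of ${\rm UOP}(k-1)$, a new vertex $v_e$ and the two edges $v_ex$ and $v_ey$; the outer edges of ${\rm UOP}(k)$ are then exactly the edges $v_ex, v_ey$ for $e=xy$ an outer edge of ${\rm UOP}(k-1)$. (${\rm UOP}(k)$ is outerplanar.) -}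

module Defs where

open import Data.Nat using (ℕ; zero; suc; _<_)
open import Data.Bool using (Bool)
open import Data.Product using (_×_; _,_; Σ; ∃-syntax)
open import Data.Sum using (_⊎_)
open import Data.List using (List; []; _∷_; length; lookup; _++_)
open import Data.Fin using (Fin; inject₁) renaming (suc to fsuc)
open import Relation.Binary.PropositionalEquality using (_≡_)
open import Function.Definitions using (Injective)

-- A finite graph with vertex set {0, …, nV - 1} and an edge list
-- (each edge stored once, as an ordered pair; edges are undirected).
record Graph : Set where
  field
    nV : ℕ
    E  : List (ℕ × ℕ)
open Graph public

record UOPData : Set where
  field
    graph : Graph
    outer : List (ℕ × ℕ)
open UOPData public

newEdges : ℕ → List (ℕ × ℕ) → List (ℕ × ℕ)
newEdges k [] = []
newEdges k ((x , y) ∷ o) = (k , x) ∷ (k , y) ∷ newEdges (suc k) o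

triangle : UOPData
triangle = record
  { graph = record { nV = 3 ; E = (0 , 1) ∷ (1 , 2) ∷ (0 , 2) ∷ [] }
  ; outer = (0 , 1) ∷ (1 , 2) ∷ (0 , 2) ∷ [] }

step : UOPData → UOPData
step D = record
  { graph = record
      { nV = nV (graph D) Data.Nat.+ length (outer D)
      ; E  = E (graph D) ++ newEdges (nV (graph D)) (outer D) }
  ; outer = newEdges (nV (graph D)) (outer D) }

-- UOP k for k ≥ 1 as in the paper (UOP 1 = triangle, UOP (k+1) = step (UOP k)).
-- The value at k = 0 is a junk value (also the triangle) and is never used.
UOP : ℕ → UOPData
UOP zero = triangle
UOP (suc zero) = triangle
UOP (suc (suc k)) = step (UOP (suc k))

-- A 2-colouring of the edges of G (Bool: true = red, false = blue).
Colouring : Graph → Set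
Colouring G = Fin (length (E G)) → Bool

MonoEdge : (G : Graph) → Colouring G → Bool → ℕ → ℕ → Set
MonoEdge G c col u v =
  Σ (Fin (length (E G))) λ j →
    (lookup (E G) j ≡ (u , v) ⊎ lookup (E G) j ≡ (v , u)) × c j ≡ col

-- G coloured by c contains a monochromatic copy of P_(m+1) (path on m+1 vertices):
-- m+1 distinct vertices of G, consecutive ones joined by edges of one colour.
HasMonoPath : (G : Graph) → Colouring G → ℕ → Set
HasMonoPath G c m =
  ∃[ col ] ∃[ v ]
    (Injective _≡_ _≡_ v
    × (∀ (i : Fin (suc m)) → v i < nV G)
    × (∀ (i : Fin m) → MonoEdge G c col (v (inject₁ i)) (v (fsuc i))))

-- A region over an edge a b of UOP(k) is the binary tree of triangles later attached to
-- a b: a vertex v adjacent to a and b, with regions over a v and v b below it.  By induction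
-- on t, a region of depth at least t (m + 2) either contains a monochromatic path on m + 1
-- vertices, or contains a monochromatic path with t edges starting at a, and, for each
-- colour c, a c-coloured path with t edges starting at a or at b, or a path of the other
-- colour from a to b through the region.  In the induction step one walks down the spine of
-- regions hanging off a.  While the spine edges at a keep the colour c, the hypothesis applied
-- to the regions beside the spine either finishes or yields a bridge of the other colour, and
-- the bridges concatenate into a path of that colour which grows at every step; after m steps
-- it has m edges.  UOP(n²) contains a region of depth n² - 1 = (n - 1)(n + 1) over an edge of
-- the initial triangle.
module Submission where

open import Defs
open import Level using (0ℓ)
open import Function using (id; _∘_; case_of_)
open import Function.Definitions using (Injective)
open import Relation.Binary.PropositionalEquality
  using (_≡_; _≢_; refl; sym; trans; cong; subst; setoid; ≢-sym)
open import Relation.Binary.Definitions using (tri<; tri≈; tri>)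
open import Relation.Unary using (Pred; _∈_; _∉_; _⊆_; _∪_; _⊥_; ∅; ｛_｝)
open import Data.Empty using (⊥-elim)
open import Data.Nat using (ℕ; zero; suc; _+_; _*_; _≤_; _<_; _≤′_; ≤′-refl; ≤′-step; z≤n; s≤s)
open import Data.Nat.Properties
  using (≤-refl; ≤-reflexive; ≤-trans; <-≤-trans; <⇒≤; <⇒≱; <-irrefl; <-cmp; ≤⇒≤′; n≤1+n;
         m≤m+n; m≤n+m; m<m+n; +-monoʳ-<; +-identityʳ; +-suc; +-comm; +-cancelˡ-≡;
         *-suc; *-cancelˡ-≡; suc-injective; even≢odd)
open import Data.Bool using (Bool; true; false; not)
open import Data.Maybe using (Maybe; just; nothing)
open import Data.Product using (_×_; _,_; proj₁; proj₂; ∃-syntax; swap)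
open import Data.Sum using (_⊎_; inj₁; inj₂; [_,_]′; map₂)
import Data.Sum.Effectful.Left as SumLeft
open import Effect.Monad using (RawMonad)
open import Data.Fin using (Fin; inject≤; inject₁) renaming (zero to fzero; suc to fsuc)
open import Data.Fin.Properties using (inject≤-injective)
open import Data.List using (List; []; _∷_; _++_; _∷ʳ_; length; reverse; lookup)
open import Data.List.Properties using (length-++; length-++-≤ʳ; unfold-reverse)
open import Data.List.Membership.Propositional using () renaming (_∈_ to _∈ₗ_)
open import Data.List.Membership.Propositional.Properties using (∈-++⁺ˡ; ∈-++⁺ʳ; ∈-lookup)
open import Data.List.Relation.Unary.All as All using (All; []; _∷_)
import Data.List.Relation.Unary.All.Properties as All
open import Data.List.Relation.Unary.AllPairs using ([]; _∷_)
import Data.List.Relation.Unary.AllPairs.Properties as AllPairs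
open import Data.List.Relation.Unary.Any using (here; there; index)
open import Data.List.Relation.Unary.Any.Properties using (lookup-index)
open import Data.List.Relation.Unary.Linked using (Linked; []; [-]; _∷_)
open import Data.List.Relation.Unary.Unique.Propositional using (Unique)
open import Data.List.Relation.Binary.Permutation.Setoid (setoid ℕ) using (↭-sym)
open import Data.List.Relation.Binary.Permutation.Setoid.Properties (setoid ℕ)
  using (↭-reverse; AllPairs-resp-↭; All-resp-↭)

same-or-opposite : (c α : Bool) → c ≡ α ⊎ c ≡ not α
same-or-opposite false false = inj₁ refl
same-or-opposite false true  = inj₂ refl
same-or-opposite true  false = inj₂ refl
same-or-opposite true  true  = inj₁ refl

∉⇒All≢ : ∀ {P : Pred ℕ 0ℓ} {w xs} → w ∉ P → All P xs → All (w ≢_) xs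
∉⇒All≢ w∉P = All.map λ { Px refl → w∉P Px }

⊥⇒All²≢ : ∀ {P Q : Pred ℕ 0ℓ} {xs ys} → P ⊥ Q → All P xs → All Q ys →
          All (λ x → All (x ≢_) ys) xs
⊥⇒All²≢ P⊥Q Pxs Qys = All.map (λ Px → ∉⇒All≢ (λ Qx → P⊥Q (Px , Qx)) Qys) Pxs

length-∷ʳ : ∀ (xs : List ℕ) x → length (xs ∷ʳ x) ≡ suc (length xs)
length-∷ʳ xs x = trans (length-++ xs) (+-comm (length xs) 1)

Unique-reverse : ∀ {xs : List ℕ} → Unique xs → Unique (reverse xs)
Unique-reverse {xs} = AllPairs-resp-↭ ≢-sym ((λ { refl p → p }) , (λ { refl p → p }))
                                      (↭-sym (↭-reverse xs))

All-reverse : ∀ {P : Pred ℕ 0ℓ} {xs} → All P xs → All P (reverse xs)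
All-reverse {xs = xs} = All-resp-↭ (λ { refl p → p }) (↭-sym (↭-reverse xs))

Linked-All : ∀ {R : ℕ → ℕ → Set} {P : Pred ℕ 0ℓ} → (∀ {u w} → R u w → P u × P w) →
             ∀ {u w ws} → Linked R (u ∷ w ∷ ws) → All P (u ∷ w ∷ ws)
Linked-All R⇒P (r ∷ [-])         = proj₁ (R⇒P r) ∷ proj₂ (R⇒P r) ∷ []
Linked-All R⇒P (r ∷ rs@(_ ∷ _)) = proj₁ (R⇒P r) ∷ Linked-All R⇒P rs

Linked-lookup : ∀ {R : ℕ → ℕ → Set} {vs n} → Linked R vs → (le : suc n ≤ length vs) (i : Fin n) →
                R (lookup vs (inject≤ (inject₁ i) le)) (lookup vs (inject≤ (fsuc i) le))
Linked-lookup [-]      (s≤s z≤n) ()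
Linked-lookup (r ∷ _)  _         fzero    = r
Linked-lookup (_ ∷ rs) (s≤s le)  (fsuc i) = Linked-lookup rs le i

lookup-injective : ∀ {vs : List ℕ} → Unique vs → ∀ {i j} → lookup vs i ≡ lookup vs j → i ≡ j
lookup-injective (_ ∷ _)      {fzero}  {fzero}  _  = refl
lookup-injective (x≢ ∷ _)     {fzero}  {fsuc j} eq = ⊥-elim (All.lookup x≢ (∈-lookup j) eq)
lookup-injective (x≢ ∷ _)     {fsuc i} {fzero}  eq = ⊥-elim (All.lookup x≢ (∈-lookup i) (sym eq))
lookup-injective (_ ∷ unique) {fsuc i} {fsuc j} eq = cong fsuc (lookup-injective unique eq)

module Regions (Edge : Bool → ℕ → ℕ → Set)
               (Edge-sym : ∀ {c u v} → Edge c u v → Edge c v u) where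

  data Region : ℕ → ℕ → ℕ → Set where
    leaf : ∀ {a b} → Region 0 a b
    node : ∀ {d a b} (v : ℕ) (α β : Bool) → Edge α a v → Edge β v b →
           Region d a v → Region d v b → Region (suc d) a b

  Interior : ∀ {d a b} → Region d a b → Pred ℕ 0ℓ
  Interior leaf                  = ∅
  Interior (node v _ _ _ _ L R) = ｛ v ｝ ∪ Interior L ∪ Interior R

  data Proper : ∀ {d a b} → Region d a b → Set where
    leaf : ∀ {a b} → Proper (leaf {a} {b})
    node : ∀ {d a b v α β} {eα : Edge α a v} {eβ : Edge β v b}
             {L : Region d a v} {R : Region d v b} →
           a ∉ Interior (node v α β eα eβ L R) → b ∉ Interior (node v α β eα eβ L R) →
           Proper L → Proper R → Interior L ⊥ Interior R →
           Proper (node v α β eα eβ L R)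

  module _ {d a b} {R : Region d a b} where

    left-end∉ : Proper R → a ∉ Interior R
    left-end∉ (node a∉ _ _ _ _) = a∉

    right-end∉ : Proper R → b ∉ Interior R
    right-end∉ (node _ b∉ _ _ _) = b∉

  flip : ∀ {d a b} → Region d a b → Region d b a
  flip leaf                  = leaf
  flip (node v α β eα eβ L R) = node v β α (Edge-sym eβ) (Edge-sym eα) (flip R) (flip L)

  Interior-flip : ∀ {d a b} (R : Region d a b) → Interior (flip R) ⊆ Interior R
  Interior-flip (node v α β eα eβ L R) (inj₁ v≡u)        = inj₁ v≡u
  Interior-flip (node v α β eα eβ L R) (inj₂ (inj₁ u∈R)) = inj₂ (inj₂ (Interior-flip R u∈R))
  Interior-flip (node v α β eα eβ L R) (inj₂ (inj₂ u∈L)) = inj₂ (inj₁ (Interior-flip L u∈L))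

  Proper-flip : ∀ {d a b} {R : Region d a b} → Proper R → Proper (flip R)
  Proper-flip leaf = leaf
  Proper-flip {R = R₀@(node v α β eα eβ L R)} (node a∉ b∉ pL pR L⊥R) =
    node (b∉ ∘ Interior-flip R₀) (a∉ ∘ Interior-flip R₀) (Proper-flip pR) (Proper-flip pL)
         (λ (u∈R , u∈L) → L⊥R (Interior-flip L u∈L , Interior-flip R u∈R))

  record Tail (c : Bool) (t u : ℕ) (P : Pred ℕ 0ℓ) : Set where
    constructor tail
    field
      {vertices} : List ℕ
      path       : Linked (Edge c) (u ∷ vertices)
      unique     : Unique vertices
      inside     : All P vertices
      long       : t ≤ length vertices

  module _ {c : Bool} {P Q : Pred ℕ 0ℓ} where

    Tail-⊆ : ∀ {t u} → P ⊆ Q → Tail c t u P → Tail c t u Q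
    Tail-⊆ P⊆Q (tail p un i l) = tail p un (All.map P⊆Q i) l

    extend : ∀ {t x w} → Edge c x w → w ∈ Q → P ⊆ Q → w ∉ P → Tail c t w P →
             Tail c (suc t) x Q
    extend e w∈Q P⊆Q w∉P (tail p un i l) =
      tail (e ∷ p) (∉⇒All≢ w∉P i ∷ un) (w∈Q ∷ All.map P⊆Q i) (s≤s l)

  shorten : ∀ {c t u P} → Tail c (suc t) u P → Tail c t u P
  shorten (tail p un i l) = tail p un i (≤-trans (n≤1+n _) l)

  -- The vertex list omits the final vertex, so that chains concatenate by _++_.
  data Chain (c : Bool) : ℕ → List ℕ → ℕ → Set where
    []  : ∀ {v} → Chain c v [] v
    _∷_ : ∀ {u w vs v} → Edge c u w → Chain c w vs v → Chain c u (u ∷ vs) v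

  module _ {c : Bool} where

    Chain-++ : ∀ {u vs w ws z} → Chain c u vs w → Chain c w ws z → Chain c u (vs ++ ws) z
    Chain-++ []       ch′ = ch′
    Chain-++ (e ∷ ch) ch′ = e ∷ Chain-++ ch ch′

    Chain-∷ʳ : ∀ {u vs w z} → Chain c u vs w → Edge c w z → Chain c u (vs ∷ʳ w) z
    Chain-∷ʳ ch e = Chain-++ ch (e ∷ [])

    Chain-reverse : ∀ {u vs w} → Chain c u (u ∷ vs) w → Chain c w (w ∷ reverse vs) u
    Chain-reverse (e ∷ []) = Edge-sym e ∷ []
    Chain-reverse {u} {w₁ ∷ vs} {w} (e ∷ ch@(_ ∷ _)) =
      subst (λ ws → Chain c w (w ∷ ws) u) (sym (unfold-reverse w₁ vs))
            (Chain-∷ʳ (Chain-reverse ch) (Edge-sym e))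

    Chain-++-Linked : ∀ {u vs w ws} → Chain c u vs w → Linked (Edge c) (w ∷ ws) →
                      Linked (Edge c) (vs ++ w ∷ ws)
    Chain-++-Linked []               p = p
    Chain-++-Linked (e ∷ [])         p = e ∷ p
    Chain-++-Linked (e ∷ ch@(_ ∷ _)) p = e ∷ Chain-++-Linked ch p

    Chain⇒Linked : ∀ {u vs w} → Chain c u vs w → Linked (Edge c) (vs ∷ʳ w)
    Chain⇒Linked ch = Chain-++-Linked ch [-]

    Chain-++-Tail : ∀ {P Q : Pred ℕ 0ℓ} {k w vs u} →
      Chain c w (w ∷ vs) u → Unique vs → All Q vs → u ∉ Q → u ∉ P → Q ⊥ P →
      Tail c k u P → Tail c (suc k) w (Q ∪ ｛ u ｝ ∪ P)
    Chain-++-Tail {vs = vs} {u} ch un-vs Q-vs u∉Q u∉P Q⊥P (tail {ws} p un i l) =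
      tail (Chain-++-Linked ch p)
           (AllPairs.++⁺ un-vs (∉⇒All≢ u∉P i ∷ un)
              (All.map (λ Qx → (λ { refl → u∉Q Qx }) ∷ ∉⇒All≢ (λ Px → Q⊥P (Qx , Px)) i) Q-vs))
           (All.++⁺ (All.map inj₁ Q-vs) (inj₂ (inj₁ refl) ∷ All.map (inj₂ ∘ inj₂) i))
           (≤-trans (s≤s l) (length-++-≤ʳ (u ∷ ws) {vs}))

  record Bridge (c : Bool) {d a b} (R : Region d a b) : Set where
    constructor bridge
    field
      {vertices} : List ℕ
      chain      : Chain c a (a ∷ vertices) b
      unique     : Unique vertices
      inside     : All (Interior R) vertices

  record MonoPath (m : ℕ) : Set where
    constructor monoPath
    field
      {colour}   : Bool
      {vertices} : List ℕ
      path       : Linked (Edge colour) vertices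
      unique     : Unique vertices
      long       : m < length vertices

  Tail⇒MonoPath : ∀ {c t u P} → u ∉ P → Tail c t u P → MonoPath t
  Tail⇒MonoPath u∉P (tail p un i l) = monoPath p (∉⇒All≢ u∉P i ∷ un) (s≤s l)

  module _ {c : Bool} {d a b v α β} {eα : Edge α a v} {eβ : Edge β v b}
           {L : Region d a v} {R : Region d v b} where

    Bridge-++-Tail : ∀ {t} → Proper (node v α β eα eβ L R) → Bridge c L → Tail c t v (Interior R) →
                     Tail c (suc t) a (Interior (node v α β eα eβ L R))
    Bridge-++-Tail (node _ _ pL pR L⊥R) (bridge ch un i) T =
      Tail-⊆ (λ { (inj₁ z∈L) → inj₂ (inj₁ z∈L) ; (inj₂ (inj₁ v≡z)) → inj₁ v≡z
                ; (inj₂ (inj₂ z∈R)) → inj₂ (inj₂ z∈R) })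
             (Chain-++-Tail ch un i (right-end∉ pL) (left-end∉ pR) L⊥R T)

    Bridge-join : Proper (node v α β eα eβ L R) → Bridge c L → Bridge c (flip R) →
                  Bridge c (node v α β eα eβ L R)
    Bridge-join (node _ _ pL pR L⊥R) (bridge chL unL inL) (bridge {ws} chR unR inR) =
      bridge (Chain-++ chL (Chain-reverse chR))
             (AllPairs.++⁺ unL (All-reverse (All.map (λ z∈R → λ { refl → left-end∉ pR z∈R }) inR′)
                                ∷ Unique-reverse unR)
                (⊥⇒All²≢ L⊥vR inL (inj₁ refl ∷ All-reverse (All.map inj₂ inR′))))
             (All.++⁺ (All.map (inj₂ ∘ inj₁) inL)
                      (inj₁ refl ∷ All-reverse (All.map (inj₂ ∘ inj₂) inR′)))
      where
        inR′ : All (Interior R) ws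
        inR′ = All.map (Interior-flip R) inR
        L⊥vR : Interior L ⊥ ｛ v ｝ ∪ Interior R
        L⊥vR (z∈L , inj₁ refl) = right-end∉ pL z∈L
        L⊥vR (z∈L , inj₂ z∈R)  = L⊥R (z∈L , z∈R)

  module Descent (m : ℕ) where

    open RawMonad (SumLeft.monad (MonoPath m) 0ℓ) using (pure; _>>=_)

    record Anchored (t : ℕ) {d a b} (R : Region d a b) : Set where
      field
        left-tail : ∃[ c ] Tail c t a (Interior R)
        split     : ∀ c → Tail c t a (Interior R) ⊎ Tail c t b (Interior R) ⊎ Bridge (not c) R

    module Step (t : ℕ)
      (ih : ∀ {d a b} {R : Region d a b} → Proper R → t * (2 + m) ≤ d →
            MonoPath m ⊎ Anchored t R) where

      module Spine {dr dl x y v} {R : Region dr x y} {L : Region dl x v}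
                   (L⊆R : Interior L ⊆ Interior R) (v∈R : v ∈ Interior R)
                   (v∉L : v ∉ Interior L) (c : Bool) where

        record Trail (k : ℕ) {dq u} (q : Region dq x u) : Set where
          constructor trail
          field
            {vertices} : List ℕ
            chain      : Chain (not c) u vertices v
            unique     : Unique vertices
            inside     : All (Interior L) vertices
            avoids     : All (_∉ Interior q) vertices
            long       : k ≤ length vertices

        record State (n : ℕ) {dq u} (q : Region dq x u) : Set where
          constructor state
          field
            proper : Proper q
            q⊆L    : Interior q ⊆ Interior L
            u∈R    : u ∈ Interior R
            hub    : Edge c x u
            {k}    : ℕ
            walk   : Trail k q
            enough : m ≤ n + k
            deep   : suc n + t * (2 + m) ≤ dq

        Outcome : Set
        Outcome = Tail c (suc t) x (Interior R) ⊎ Bridge (not c) L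

        Trail⇒MonoPath : ∀ {k dq u} {q : Region dq x u} → m ≤ k → Trail k q → MonoPath m
        Trail⇒MonoPath m≤k (trail {vs} ch un i _ l) =
          monoPath (Chain⇒Linked ch)
                   (AllPairs.++⁺ un ([] ∷ []) (All.map (λ v′∈L → (λ { refl → v∉L v′∈L }) ∷ []) i))
                   (subst (m <_) (sym (length-∷ʳ vs v)) (s≤s (≤-trans m≤k l)))

        Trail⇒Bridge : ∀ {k dq u} {q : Region dq x u} → Edge (not c) x u → Trail k q →
                       Bridge (not c) L
        Trail⇒Bridge e (trail ch un i _ _) = bridge (e ∷ ch) un i

        grow : ∀ {k dq u v′ α β} {eα : Edge α x v′} {eβ : Edge β v′ u}
                 {l : Region dq x v′} {r : Region dq v′ u} →
               Proper (node v′ α β eα eβ l r) → Interior (node v′ α β eα eβ l r) ⊆ Interior L →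
               Bridge (not c) r → Trail k (node v′ α β eα eβ l r) → Trail (suc k) l
        grow {k} (node _ _ pl pr l⊥r) q⊆L (bridge {bs} bch bun bi) (trail {cs} ch un i av long) =
          trail (Chain-++ bch ch)
                (All.++⁺ (∉⇒All≢ (left-end∉ pr) bi) (∉⇒All≢ (λ v′∉q → v′∉q (inj₁ refl)) av)
                 ∷ AllPairs.++⁺ bun un (⊥⇒All²≢ (λ (b∈r , b∉q) → b∉q (inj₂ (inj₂ b∈r))) bi av))
                (q⊆L (inj₁ refl) ∷ All.++⁺ (All.map (q⊆L ∘ inj₂ ∘ inj₂) bi) i)
                (right-end∉ pl ∷ All.++⁺ (All.map (λ b∈r b∈l → l⊥r (b∈l , b∈r)) bi)
                                          (All.map (λ z∉q z∈l → z∉q (inj₂ (inj₁ z∈l))) av))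
                (s≤s (≤-trans long (length-++-≤ʳ cs {bs})))

        find-bridge : ∀ {n dq u v′ α β} {eα : Edge α x v′} {eβ : Edge β v′ u}
                       {l : Region dq x v′} {r : Region dq v′ u} →
                     State (suc n) (node v′ α β eα eβ l r) →
                     MonoPath m ⊎ Tail c (suc t) x (Interior R) ⊎ Bridge (not c) r
        find-bridge {n} {β = β} {eβ = eβ} (state pq@(node _ _ _ pr _) q⊆L u∈R hub _ _ (s≤s deep))
          with same-or-opposite β c
        ... | inj₂ refl = pure (inj₂ (bridge (eβ ∷ []) [] []))
        ... | inj₁ refl = do
          A ← ih pr (≤-trans (m≤n+m _ (suc n)) deep)
          pure (case Anchored.split A c of λ where
            (inj₁ T) → inj₁ (shorten (extend hub u∈R (L⊆R ∘ q⊆L) (right-end∉ pq)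
                                (extend (Edge-sym eβ) (inj₁ refl) (inj₂ ∘ inj₂) (left-end∉ pr) T)))
            (inj₂ (inj₁ T)) → inj₁ (extend hub u∈R (L⊆R ∘ q⊆L ∘ inj₂ ∘ inj₂) (right-end∉ pr) T)
            (inj₂ (inj₂ B)) → inj₂ B)

        advance : ∀ {n dq u v′ α β} {eα : Edge α x v′} {eβ : Edge β v′ u}
                    {l : Region dq x v′} {r : Region dq v′ u} →
                  State (suc n) (node v′ α β eα eβ l r) → Bridge (not c) r → Outcome ⊎ State n l
        advance {n} {α = α} {eα = eα}
                (state pq@(node _ _ pl _ _) q⊆L _ _ {k} walk enough (s≤s deep)) B
          with same-or-opposite α c
        ... | inj₁ refl = inj₂ (state pl (q⊆L ∘ inj₂ ∘ inj₁) (L⊆R (q⊆L (inj₁ refl))) eα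
                                      (grow pq q⊆L B walk) (subst (m ≤_) (sym (+-suc n k)) enough)
                                      deep)
        ... | inj₂ refl = inj₁ (inj₂ (Trail⇒Bridge eα (grow pq q⊆L B walk)))

        descend : ∀ n {dq u} {q : Region dq x u} → State n q → MonoPath m ⊎ Outcome
        descend zero    s = inj₁ (Trail⇒MonoPath (State.enough s) (State.walk s))
        descend (suc n) {q = leaf} (state _ _ _ _ _ _ ())
        descend (suc n) {q = node _ _ _ _ _ _ _} s =
          map₂ [ inj₁ ∘ inj₁ , advance s ]′ (find-bridge s) >>= [ pure , descend n ]′

        tail-or-bridge : ∀ {α} → Edge α x v → Proper L → suc m + t * (2 + m) ≤ dl →
                         MonoPath m ⊎ Outcome
        tail-or-bridge {α} eα pL deep with same-or-opposite α c
        ... | inj₁ refl = descend m (state pL id v∈R eα (trail [] [] [] [] z≤n) (m≤m+n m 0) deep)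
        ... | inj₂ refl = pure (inj₂ (bridge (eα ∷ []) [] []))

      module _ {d x y v α β} {eα : Edge α x v} {eβ : Edge β v y}
               {L : Region d x v} {R : Region d v y} where

        tail-or-bridgeˡ : Proper (node v α β eα eβ L R) → suc m + t * (2 + m) ≤ d → (c : Bool) →
                          MonoPath m ⊎ Tail c (suc t) x (Interior (node v α β eα eβ L R))
                                      ⊎ Bridge (not c) L
        tail-or-bridgeˡ (node _ _ pL _ _) deep c =
          Spine.tail-or-bridge {R = node v α β eα eβ L R} (inj₂ ∘ inj₁) (inj₁ refl) (right-end∉ pL) c
                               eα pL deep

      split-suc : ∀ {d a b} {R : Region (suc d) a b} → Proper R → suc m + t * (2 + m) ≤ d →
                  (c : Bool) → MonoPath m ⊎ Tail c (suc t) a (Interior R) ⊎ Tail c (suc t) b (Interior R)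
                                          ⊎ Bridge (not c) R
      split-suc {R = R} pR@(node _ _ _ _ _) deep c = do
        inj₂ Bˡ ← tail-or-bridgeˡ pR deep c
          where inj₁ T → pure (inj₁ T)
        inj₂ Bʳ ← tail-or-bridgeˡ (Proper-flip pR) deep c
          where inj₁ T → pure (inj₂ (inj₁ (Tail-⊆ (Interior-flip R) T)))
        pure (inj₂ (inj₂ (Bridge-join pR Bˡ Bʳ)))

      left-tail-suc : ∀ {d x y v α β} {eα : Edge α x v} {eβ : Edge β v y}
                        {L : Region d x v} {R : Region d v y} →
                      Proper (node v α β eα eβ L R) → suc m + t * (2 + m) ≤ d →
                      ∀ {c} → Tail c t v (Interior R) →
                      MonoPath m ⊎ ∃[ c ] Tail c (suc t) x (Interior (node v α β eα eβ L R))
      left-tail-suc {α = α} {eα = eα} pN@(node _ _ _ pR _) deep {c} T with same-or-opposite c α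
      ... | inj₁ refl = pure (α , extend eα (inj₁ refl) (inj₂ ∘ inj₂) (left-end∉ pR) T)
      ... | inj₂ refl = map₂ [ (α ,_) , (λ B → not α , Bridge-++-Tail pN B T) ]′
                             (tail-or-bridgeˡ pN deep α)

      anchored-suc : ∀ {d a b} {R : Region d a b} → Proper R → suc t * (2 + m) ≤ d →
                     MonoPath m ⊎ Anchored (suc t) R
      anchored-suc leaf ()
      anchored-suc pN@(node _ _ _ pR _) (s≤s deep) = do
        A ← ih pR (≤-trans (m≤n+m _ (suc m)) deep)
        T ← left-tail-suc pN deep (proj₂ (Anchored.left-tail A))
        split-false ← split-suc pN deep false
        split-true ← split-suc pN deep true
        pure (record { left-tail = T ; split = λ { false → split-false ; true → split-true } })

    anchored : ∀ t {d a b} {R : Region d a b} → Proper R → t * (2 + m) ≤ d →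
               MonoPath m ⊎ Anchored t R
    anchored zero    _ _ = pure (record { left-tail = true , trivial ; split = λ _ → inj₁ trivial })
      where
        trivial : ∀ {c u P} → Tail c 0 u P
        trivial = tail [-] [] [] z≤n
    anchored (suc t) = Step.anchored-suc t (anchored t)

    deep-region⇒MonoPath : ∀ {d a b} {R : Region d a b} → Proper R → m * (2 + m) ≤ d → MonoPath m
    deep-region⇒MonoPath pR deep =
      [ id , (λ A → Tail⇒MonoPath (left-end∉ pR) (proj₂ (Anchored.left-tail A))) ]′
      (anchored m pR deep)

module _ {A : Set} where

  _at_ : List A → ℕ → Maybe A
  []       at _     = nothing
  (x ∷ xs) at zero  = just x
  (x ∷ xs) at suc n = xs at n

  at⇒∈ : ∀ xs {n e} → xs at n ≡ just e → e ∈ₗ xs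
  at⇒∈ (x ∷ xs) {zero}  refl = here refl
  at⇒∈ (x ∷ xs) {suc n} h    = there (at⇒∈ xs h)

  at⇒< : ∀ xs {n e} → xs at n ≡ just e → n < length xs
  at⇒< (x ∷ xs) {zero}  _ = s≤s z≤n
  at⇒< (x ∷ xs) {suc n} h = s≤s (at⇒< xs h)

  All-at : ∀ {P : Pred A 0ℓ} {xs n e} → All P xs → xs at n ≡ just e → P e
  All-at {n = zero}  (px ∷ _)   refl = px
  All-at {n = suc n} (_  ∷ pxs) h    = All-at pxs h

Below : ℕ → Pred (ℕ × ℕ) 0ℓ
Below n (x , y) = x < n × y < n

module _ {x y : ℕ} where

  newEdges-at-even : ∀ k o i → o at i ≡ just (x , y) → newEdges k o at (2 * i) ≡ just (k + i , x)
  newEdges-at-even k (_ ∷ o) zero    refl = cong (λ z → just (z , x)) (sym (+-identityʳ k))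
  newEdges-at-even k (_ ∷ o) (suc i) h rewrite +-suc i (i + 0) =
    trans (newEdges-at-even (suc k) o i h) (cong (λ z → just (z , x)) (sym (+-suc k i)))

  newEdges-at-odd : ∀ k o i → o at i ≡ just (x , y) → newEdges k o at suc (2 * i) ≡ just (k + i , y)
  newEdges-at-odd k (_ ∷ o) zero    refl = cong (λ z → just (z , y)) (sym (+-identityʳ k))
  newEdges-at-odd k (_ ∷ o) (suc i) h rewrite +-suc i (i + 0) =
    trans (newEdges-at-odd (suc k) o i h) (cong (λ z → just (z , y)) (sym (+-suc k i)))

All-Below-newEdges : ∀ {n} n′ k o → n ≤ n′ → k + length o ≤ n′ → All (Below n) o →
                     All (Below n′) (newEdges k o)
All-Below-newEdges n′ k []             _    _  []                 = []
All-Below-newEdges n′ k ((x , y) ∷ o) n≤n′ le ((x< , y<) ∷ below) =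
  (k< , ≤-trans x< n≤n′) ∷ (k< , ≤-trans y< n≤n′) ∷
  All-Below-newEdges n′ (suc k) o n≤n′ (subst (_≤ n′) (+-suc k (length o)) le) below
  where
    k< : k < n′
    k< = <-≤-trans (m<m+n k (s≤s z≤n)) le

Stage : ℕ → UOPData
Stage k = UOP (suc k)

N : ℕ → ℕ
N k = nV (graph (Stage k))

O : ℕ → List (ℕ × ℕ)
O k = outer (Stage k)

Es : ℕ → List (ℕ × ℕ)
Es k = E (graph (Stage k))

N-mono : ∀ {j k} → j ≤ k → N j ≤ N k
N-mono = go ∘ ≤⇒≤′
  where
    go : ∀ {j k} → j ≤′ k → N j ≤ N k
    go ≤′-refl           = ≤-refl
    go (≤′-step {k} j≤k) = ≤-trans (go j≤k) (m≤m+n (N k) (length (O k)))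

Es-mono : ∀ {j k e} → j ≤ k → e ∈ₗ Es j → e ∈ₗ Es k
Es-mono = go ∘ ≤⇒≤′
  where
    go : ∀ {j k e} → j ≤′ k → e ∈ₗ Es j → e ∈ₗ Es k
    go ≤′-refl       = λ e∈ → e∈
    go (≤′-step j≤k) = ∈-++⁺ˡ ∘ go j≤k

O⊆Es : ∀ k {e} → e ∈ₗ O k → e ∈ₗ Es k
O⊆Es zero    = λ e∈ → e∈
O⊆Es (suc k) = ∈-++⁺ʳ (Es k)

Es-O-below : ∀ k → All (Below (N k)) (Es k) × All (Below (N k)) (O k)
Es-O-below zero = triangle-below , triangle-below
  where
    triangle-below : All (Below 3) ((0 , 1) ∷ (1 , 2) ∷ (0 , 2) ∷ [])
    triangle-below = (s≤s z≤n , s≤s (s≤s z≤n)) ∷ (s≤s (s≤s z≤n) , s≤s (s≤s (s≤s z≤n)))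
                   ∷ (s≤s z≤n , s≤s (s≤s (s≤s z≤n))) ∷ []
Es-O-below (suc k) with Es-O-below k
... | Es-below , O-below =
  All.++⁺ (All.map (λ (x< , y<) → ≤-trans x< Nk≤ , ≤-trans y< Nk≤) Es-below) new , new
  where
    Nk≤ : N k ≤ N (suc k)
    Nk≤ = m≤m+n (N k) (length (O k))
    new : All (Below (N (suc k))) (O (suc k))
    new = All-Below-newEdges (N (suc k)) (N k) (O k) Nk≤ ≤-refl O-below

label-level-injective : ∀ {k k′ p p′} → N k + p ≡ N k′ + p′ →
                        p < length (O k) → p′ < length (O k′) → k ≡ k′
label-level-injective {k} {k′} {p} {p′} eq p< p′< with <-cmp k k′
... | tri≈ _ k≡k′ _ = k≡k′
... | tri< k<k′ _ _ = ⊥-elim (<⇒≱ (+-monoʳ-< (N k) p<)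
  (≤-trans (N-mono k<k′) (≤-trans (m≤m+n (N k′) p′) (≤-reflexive (sym eq)))))
... | tri> _ _ k′<k = ⊥-elim (<⇒≱ (+-monoʳ-< (N k′) p′<)
  (≤-trans (N-mono k′<k) (≤-trans (m≤m+n (N k) p) (≤-reflexive eq))))

IsChild : ℕ → ℕ → Set
IsChild i j = j ≡ 2 * i ⊎ j ≡ suc (2 * i)

IsChild-injective : ∀ {i i′ j} → IsChild i j → IsChild i′ j → i ≡ i′
IsChild-injective {i} {i′} (inj₁ refl) (inj₁ e) = *-cancelˡ-≡ i i′ 2 e
IsChild-injective {i} {i′} (inj₁ refl) (inj₂ e) = ⊥-elim (even≢odd i i′ e)
IsChild-injective {i} {i′} (inj₂ refl) (inj₁ e) = ⊥-elim (even≢odd i′ i (sym e))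
IsChild-injective {i} {i′} (inj₂ refl) (inj₂ e) = *-cancelˡ-≡ i i′ 2 (suc-injective e)

data Descendant : ℕ → ℕ → ℕ → ℕ → Set where
  here  : ∀ {k p} → Descendant k p k p
  child : ∀ {ℓ i j k p} → IsChild i j → Descendant (suc ℓ) j k p → Descendant ℓ i k p

Descendant⇒≤ : ∀ {ℓ i k p} → Descendant ℓ i k p → ℓ ≤ k
Descendant⇒≤ here        = ≤-refl
Descendant⇒≤ (child _ d) = <⇒≤ (Descendant⇒≤ d)

Descendant-unique : ∀ {ℓ i i′ k p} → Descendant ℓ i k p → Descendant ℓ i′ k p → i ≡ i′
Descendant-unique here         here          = refl
Descendant-unique here         (child _ d′)  = ⊥-elim (<-irrefl refl (Descendant⇒≤ d′))
Descendant-unique (child _ d)  here          = ⊥-elim (<-irrefl refl (Descendant⇒≤ d))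
Descendant-unique (child c d)  (child c′ d′) with Descendant-unique d d′
... | refl = IsChild-injective c c′

-- The vertex attached to the p-th outer edge of stage k is N k + p (see newEdges).
record Offspring (ℓ i u : ℕ) : Set where
  constructor offspring
  field
    {k p}    : ℕ
    lineage  : Descendant ℓ i k p
    position : p < length (O k)
    label    : u ≡ N k + p

Offspring-child : ∀ {ℓ i j} → IsChild i j → Offspring (suc ℓ) j ⊆ Offspring ℓ i
Offspring-child c (offspring d p< eq) = offspring (child c d) p< eq

Offspring-≥ : ∀ {ℓ i u} → Offspring ℓ i u → N ℓ ≤ u
Offspring-≥ {u = u} (offspring {k} {p} d _ refl) = ≤-trans (N-mono (Descendant⇒≤ d)) (m≤m+n (N k) p)

Offspring-disjoint : ∀ {ℓ i j} → i ≢ j → Offspring ℓ i ⊥ Offspring ℓ j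
Offspring-disjoint i≢j (offspring {k} {p} d p< refl , offspring {k′} {p′} d′ p′< eq)
  with label-level-injective {k} {k′} eq p< p′<
... | refl with +-cancelˡ-≡ (N k) p p′ eq
... | refl = i≢j (Descendant-unique d d′)

data Outer (ℓ i a b : ℕ) : Set where
  forward  : O ℓ at i ≡ just (a , b) → Outer ℓ i a b
  backward : O ℓ at i ≡ just (b , a) → Outer ℓ i a b

Outer-below : ∀ {ℓ i a b} → Outer ℓ i a b → a < N ℓ × b < N ℓ
Outer-below {ℓ} (forward h)  = All-at (proj₂ (Es-O-below ℓ)) h
Outer-below {ℓ} (backward h) = swap (All-at (proj₂ (Es-O-below ℓ)) h)

Outer-position : ∀ {ℓ i a b} → Outer ℓ i a b → i < length (O ℓ)
Outer-position {ℓ} (forward h)  = at⇒< (O ℓ) h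
Outer-position {ℓ} (backward h) = at⇒< (O ℓ) h

record Fork (ℓ i a b : ℕ) : Set where
  field
    {l r}   : ℕ
    l-child : IsChild i l
    r-child : IsChild i r
    l≢r     : l ≢ r
    l-outer : Outer (suc ℓ) l a (N ℓ + i)
    r-outer : Outer (suc ℓ) r (N ℓ + i) b

fork : ∀ {ℓ i a b} → Outer ℓ i a b → Fork ℓ i a b
fork {ℓ} {i} (forward h) = record
  { l-child = inj₁ refl ; r-child = inj₂ refl ; l≢r = even≢odd i i
  ; l-outer = backward (newEdges-at-even (N ℓ) (O ℓ) i h)
  ; r-outer = forward (newEdges-at-odd (N ℓ) (O ℓ) i h) }
fork {ℓ} {i} (backward h) = record
  { l-child = inj₂ refl ; r-child = inj₁ refl ; l≢r = even≢odd i i ∘ sym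
  ; l-outer = backward (newEdges-at-odd (N ℓ) (O ℓ) i h)
  ; r-outer = forward (newEdges-at-even (N ℓ) (O ℓ) i h) }

HasMonoPath-from-list : ∀ {G col c m} {vs : List ℕ} → Linked (MonoEdge G col c) vs → Unique vs →
                        All (_< nV G) vs → m < length vs → HasMonoPath G col m
HasMonoPath-from-list {c = c} {m} {vs} path unique below long =
  c , v , v-injective , (λ i → All.lookup below (∈-lookup _)) , Linked-lookup path long
  where
    v : Fin (suc m) → ℕ
    v i = lookup vs (inject≤ i long)
    v-injective : Injective _≡_ _≡_ v
    v-injective eq = inject≤-injective long long _ _ (lookup-injective unique eq)

module Construction (K : ℕ) (col : Colouring (graph (Stage K))) where

  G : Graph
  G = graph (Stage K)

  Edge : Bool → ℕ → ℕ → Set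
  Edge = MonoEdge G col

  Edge-sym : ∀ {c u v} → Edge c u v → Edge c v u
  Edge-sym (j , inj₁ e , cj) = j , inj₂ e , cj
  Edge-sym (j , inj₂ e , cj) = j , inj₁ e , cj

  open Regions Edge Edge-sym public

  ∈⇒Edge : ∀ {a b} → (a , b) ∈ₗ E G → ∃[ α ] Edge α a b
  ∈⇒Edge e∈ = col (index e∈) , index e∈ , inj₁ (sym (lookup-index e∈)) , refl

  Outer⇒Edge : ∀ {ℓ i a b} → ℓ ≤ K → Outer ℓ i a b → ∃[ α ] Edge α a b
  Outer⇒Edge {ℓ} ℓ≤K (forward h)  = ∈⇒Edge (Es-mono ℓ≤K (O⊆Es ℓ (at⇒∈ (O ℓ) h)))
  Outer⇒Edge {ℓ} ℓ≤K (backward h) with ∈⇒Edge (Es-mono ℓ≤K (O⊆Es ℓ (at⇒∈ (O ℓ) h)))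
  ... | β , e = β , Edge-sym e

  build : ∀ ℓ d i {a b} → Outer ℓ i a b → ℓ + d ≤ K → Region d a b
  build ℓ zero    i o le = leaf
  build ℓ (suc d) i o le =
    node (N ℓ + i) _ _ (proj₂ (Outer⇒Edge ℓ<K l-outer)) (proj₂ (Outer⇒Edge ℓ<K r-outer))
         (build (suc ℓ) d l l-outer le′) (build (suc ℓ) d r r-outer le′)
    where
      open Fork (fork o)
      le′ : suc ℓ + d ≤ K
      le′ = subst (_≤ K) (+-suc ℓ d) le
      ℓ<K : suc ℓ ≤ K
      ℓ<K = ≤-trans (m≤m+n (suc ℓ) d) le′

  build-interior : ∀ ℓ d i {a b} (o : Outer ℓ i a b) (le : ℓ + d ≤ K) →
                   Interior (build ℓ d i o le) ⊆ Offspring ℓ i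
  build-interior ℓ (suc d) i o le = λ where
      (inj₁ refl)        → offspring here (Outer-position o) refl
      (inj₂ (inj₁ u∈l)) → Offspring-child l-child (build-interior (suc ℓ) d l l-outer _ u∈l)
      (inj₂ (inj₂ u∈r)) → Offspring-child r-child (build-interior (suc ℓ) d r r-outer _ u∈r)
    where open Fork (fork o)

  build-proper : ∀ ℓ d i {a b} (o : Outer ℓ i a b) (le : ℓ + d ≤ K) → Proper (build ℓ d i o le)
  build-proper ℓ zero    i o le = leaf
  build-proper ℓ (suc d) i o le =
    node (outside (proj₁ (Outer-below o))) (outside (proj₂ (Outer-below o)))
         (build-proper (suc ℓ) d l l-outer _) (build-proper (suc ℓ) d r r-outer _)
         (λ (u∈l , u∈r) → Offspring-disjoint l≢r (build-interior (suc ℓ) d l l-outer _ u∈l ,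
                                                  build-interior (suc ℓ) d r r-outer _ u∈r))
    where
      open Fork (fork o)
      outside : ∀ {x} → x < N ℓ → x ∉ Interior (build ℓ (suc d) i o le)
      outside x< x∈ = <⇒≱ x< (Offspring-≥ (build-interior ℓ (suc d) i o le x∈))

  lookup-below : ∀ j → Below (N K) (lookup (E G) j)
  lookup-below j = All.lookup (proj₁ (Es-O-below K)) (∈-lookup j)

  Edge-below : ∀ {c u v} → Edge c u v → u < N K × v < N K
  Edge-below (j , inj₁ eq , _) = subst (Below (N K)) eq (lookup-below j)
  Edge-below (j , inj₂ eq , _) = swap (subst (Below (N K)) eq (lookup-below j))

  root-proper : Proper (build 0 K 0 (forward refl) ≤-refl)
  root-proper = build-proper 0 K 0 (forward refl) ≤-refl

  MonoPath⇒HasMonoPath : ∀ {m} → MonoPath (suc m) → HasMonoPath G col (suc m)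
  MonoPath⇒HasMonoPath (monoPath [-] _ (s≤s ()))
  MonoPath⇒HasMonoPath (monoPath path@(_ ∷ _) unique long) =
    HasMonoPath-from-list {G = G} path unique (Linked-All Edge-below path) long

lemma2 : (m : ℕ) → (c : Colouring (graph (UOP (suc m * suc m))))
    → HasMonoPath (graph (UOP (suc m * suc m))) c m
-- A single vertex; for m > 0 the vertices of the path are bounded through its edges.
lemma2 zero    c = true , (λ _ → 0) , (λ { {fzero} {fzero} _ → refl }) , (λ { fzero → s≤s z≤n })
                 , λ ()
lemma2 (suc m) c = MonoPath⇒HasMonoPath (deep-region⇒MonoPath root-proper depth)
  where
    open Construction (suc m + suc m * suc (suc m)) c
    open Descent (suc m)
    depth : suc m * (2 + suc m) ≤ suc m + suc m * suc (suc m)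
    depth = ≤-reflexive (*-suc (suc m) (suc (suc m)))
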